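{- For $k\ge1$ let $f_k:\{0,1\}^{2^k-1}\to\{0,1\}$ be the function computed by the following decision tree: a full binary tree of depth $k$ whose $2^k-1$ internal nodes each query a distinct variable, where at each node the left child is followed when the queried variable is $0$ and the right child when it is $1$, and each internal node at the deepest level $k$ has left leaf child labeled $0$ and right leaf child labeled $1$. Then for every $k\ge1$, $\mathsf{alt}(f_k)=2^{\mathsf{DT}(f_k)}-1$.
   Context: $\mathsf{alt}(f)$ is the maximum, over chains $0^n=x_0\prec x_1\prec\dots\prec x_n=1^n$ of distinct inputs (with $\prec$ the coordinatewise order), of the number of $i$ with $f(x_{i-1})\ne f(x_i)$. $\mathsf{DT}(f)$ is the minimum depth of a deterministic decision tree computing $f$. -}

module Defs where

open import Data.Nat using (ℕ; zero; suc; _+_; _≤_; _⊔_; _^_; _∸_; NonZero)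
open import Data.Bool using (Bool; true; false; if_then_else_; _xor_)
  renaming (_≤_ to _≤ᵇ_)
open import Data.Fin using (Fin; zero; suc; inject₁; fromℕ; _↑ˡ_; _↑ʳ_)
open import Data.Vec using (Vec; lookup; replicate)
open import Data.Vec.Relation.Binary.Pointwise.Inductive using (Pointwise)
open import Data.Product using (Σ; _×_; ∃)
open import Relation.Binary.PropositionalEquality using (_≡_; _≢_; refl; sym; trans; cong; cong₂)
open import Data.Nat.Properties using (+-suc; +-identityʳ)

-- Inputs in {0,1}^n are Vec Bool n (false = 0, true = 1).
BoolFun : ℕ → Set
BoolFun n = Vec Bool n → Bool

_≼_ : ∀ {n} → Vec Bool n → Vec Bool n → Set
x ≼ y = Pointwise _≤ᵇ_ x y

_≺_ : ∀ {n} → Vec Bool n → Vec Bool n → Set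
x ≺ y = (x ≼ y) × (x ≢ y)

record Chain (n : ℕ) : Set where
  field
    pt    : Fin (suc n) → Vec Bool n
    start : pt zero ≡ replicate n false
    end   : pt (fromℕ n) ≡ replicate n true
    step  : (i : Fin n) → pt (inject₁ i) ≺ pt (suc i)
open Chain public

countTrue : ∀ {n} → (Fin n → Bool) → ℕ
countTrue {zero}  p = 0
countTrue {suc n} p = (if p zero then 1 else 0) + countTrue (λ i → p (suc i))

alternations : ∀ {n} → BoolFun n → Chain n → ℕ
alternations f c = countTrue (λ i → f (pt c (inject₁ i)) xor f (pt c (suc i)))

IsAlt : ∀ {n} → BoolFun n → ℕ → Set
IsAlt {n} f a = (Σ (Chain n) λ c → alternations f c ≡ a)
              × ((c : Chain n) → alternations f c ≤ a)

data DTree (n : ℕ) : Set where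
  leaf : Bool → DTree n
  node : Fin n → DTree n → DTree n → DTree n

eval : ∀ {n} → DTree n → Vec Bool n → Bool
eval (leaf b)     x = b
eval (node i l r) x = if lookup x i then eval r x else eval l x

depth : ∀ {n} → DTree n → ℕ
depth (leaf _)     = 0
depth (node _ l r) = suc (depth l ⊔ depth r)

Computes : ∀ {n} → DTree n → BoolFun n → Set
Computes t f = ∀ x → eval t x ≡ f x

IsDT : ∀ {n} → BoolFun n → ℕ → Set
IsDT {n} f d = (Σ (DTree n) λ t → Computes t f × depth t ≡ d)
             × ((t : DTree n) → Computes t f → d ≤ depth t)

sz : ℕ → ℕ
sz zero    = 0
sz (suc k) = suc (sz k + sz k)

relabel : ∀ {m n} → (Fin m → Fin n) → DTree m → DTree n
relabel ρ (leaf b)     = leaf b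
relabel ρ (node i l r) = node (ρ i) (relabel ρ l) (relabel ρ r)

-- full tree of depth (suc k); variable layout: root = 0, left subtree's
-- variables 1 .. sz(k+1), right subtree's variables the next sz(k+1) ones.
full : (k : ℕ) → DTree (sz (suc k))
full zero    = node zero (leaf false) (leaf true)
full (suc k) = node zero (relabel (λ i → suc (i ↑ˡ sz (suc k))) (full k))
                         (relabel (λ i → suc (sz (suc k) ↑ʳ i)) (full k))

fTree : (k : ℕ) → .{{_ : NonZero k}} → DTree (sz k)
fTree (suc k) = full k

f : (k : ℕ) → .{{_ : NonZero k}} → BoolFun (sz k)
f k = eval (fTree k)

sz-spec : ∀ k → suc (sz k) ≡ 2 ^ k
sz-spec zero = refl
sz-spec (suc k) = trans (sym (+-suc (suc (sz k)) (sz k)))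
  (trans (cong₂ _+_ (sz-spec k) (sz-spec k)) (cong (2 ^ k +_) (sym (+-identityʳ (2 ^ k)))))

module Submission where

-- * alt ≤ s holds for every function of s variables: a chain has only s steps.
-- * alt ≥ s: we build an alternating path of length s from 0^s to 1^s, i.e. a
--   monotone sequence of inputs on which the function changes at every step.
--   By induction on k: walk through the left subtree with the root and the
--   right block at 0, then set the root and the whole left block to 1 in one
--   step (one more alternation), then walk through the right subtree.  A decision tree whose value at x changes
--   when any one of m distinct coordinates is changed has depth ≥ m.  The input
--   that is 0 on the leftmost root-to-leaf path and 1 elsewhere has value 0, and
--   setting any of the k+1 variables on that path to 1 gives value 1.

open import Defs
open import Data.Nat using (ℕ; zero; suc; _+_; _≤_; _<_; _^_; _∸_; _⊔_; _≤?_; NonZero;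
  z≤n; s≤s; ≢-nonZero⁻¹)
open import Data.Nat.Properties using (≤-refl; ≤-trans; <⇒≤; <-cmp; 1+n≰n; m≤m+n;
  n≤1+n; m≤m⊔n; m≤n⊔m; ⊔-idem; +-identityʳ; +-suc; +-cancelˡ-<; m+n∸m≡n;
  m≤n⇒m≤1+n; m≤n⇒∃[o]m+o≡n)
open import Data.Bool using (Bool; true; false; if_then_else_; _xor_; f≤t; b≤b)
open import Data.Bool.Properties using (xor-same) renaming (≤-refl to ≤ᵇ-refl)
open import Data.Fin using (Fin; zero; suc; inject₁; toℕ; _↑ˡ_; _↑ʳ_; punchIn)
open import Data.Fin.Properties using (any?; punchIn-injective; punchInᵢ≢i; suc-injective;
  ↑ˡ-injective; toℕ-inject₁; toℕ-fromℕ; toℕ<n) renaming (_≟_ to _≟ᶠ_)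
open import Data.Vec using (Vec; []; _∷_; lookup; replicate; _++_; splitAt; _[_]≔_)
open import Data.Vec.Properties using (lookup-++ˡ; lookup-++ʳ; lookup-replicate;
  lookup∘update; lookup∘update′)
open import Data.Vec.Relation.Binary.Pointwise.Inductive using ([]; _∷_; ++⁺)
  renaming (refl to pointwise-refl)
open import Data.Product using (Σ; _×_; _,_; ∃; ∃₂; proj₂)
open import Data.Empty using (⊥-elim)
open import Function.Definitions using (Injective)
open import Relation.Binary using (tri<; tri≈; tri>)
open import Relation.Binary.PropositionalEquality using (_≡_; _≢_; refl; sym; trans;
  cong; cong₂; subst₂)
open import Relation.Nullary using (yes; no; contradiction)

countTrue-≤ : ∀ {n} (p : Fin n → Bool) → countTrue p ≤ n
countTrue-≤ {zero}  p = z≤n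
countTrue-≤ {suc n} p with p zero
... | true  = s≤s (countTrue-≤ (λ i → p (suc i)))
... | false = m≤n⇒m≤1+n (countTrue-≤ (λ i → p (suc i)))

countTrue-all : ∀ {n} (p : Fin n → Bool) → (∀ i → p i ≡ true) → countTrue p ≡ n
countTrue-all {zero}  p all-true = refl
countTrue-all {suc n} p all-true rewrite all-true zero =
  cong suc (countTrue-all (λ i → p (suc i)) (λ i → all-true (suc i)))

alternations-≤ : ∀ {n} (g : BoolFun n) (c : Chain n) → alternations g c ≤ n
alternations-≤ g c = countTrue-≤ _

false≢true : false ≢ true
false≢true ()

≼-refl : ∀ {n} {x : Vec Bool n} → x ≼ x
≼-refl = pointwise-refl ≤ᵇ-refl

AltStep : ∀ {n} → BoolFun n → Vec Bool n → Vec Bool n → Set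
AltStep g x y = x ≼ y × (g x xor g y ≡ true)

altStep⇒≺ : ∀ {n} {g : BoolFun n} {x y} → AltStep g x y → x ≺ y
altStep⇒≺ {g = g} (x≼y , changes) =
  x≼y , λ { refl → false≢true (trans (sym (xor-same (g _))) changes) }

record AltPath {n} (g : BoolFun n) (len : ℕ) (u v : Vec Bool n) : Set where
  field
    point : ℕ → Vec Bool n
    first : point 0 ≡ u
    last  : point len ≡ v
    steps : ∀ m → m < len → AltStep g (point m) (point (suc m))
open AltPath

stay : ∀ {n} {g : BoolFun n} u → AltPath g 0 u u
stay u = record { point = λ _ → u ; first = refl ; last = refl ; steps = λ _ () }

mapPath : ∀ {m n} {g : BoolFun m} {g' : BoolFun n} {len u v}
  (h : Vec Bool m → Vec Bool n) → (∀ {x y} → x ≼ y → h x ≼ h y) →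
  (∀ x → g' (h x) ≡ g x) → AltPath g len u v → AltPath g' len (h u) (h v)
mapPath h h-mono h-pres P = record
  { point = λ m → h (point P m)
  ; first = cong h (first P)
  ; last  = cong h (last P)
  ; steps = λ m m<len → let (x≼y , changes) = steps P m m<len in
      h-mono x≼y , trans (cong₂ _xor_ (h-pres _) (h-pres _)) changes
  }

joinPath : ∀ {n} {g : BoolFun n} {s t u v u' w} →
  AltPath g s u v → AltStep g v u' → AltPath g t u' w → AltPath g (suc (s + t)) u w
joinPath {g = g} {s} {t} P jump Q = record
  { point = J ; first = trans (J-before z≤n) (first P) ; last = trans (J-after t refl) (last Q)
  ; steps = J-steps }
  where
  J : ℕ → Vec Bool _
  J m with m ≤? s
  ... | yes _ = point P m
  ... | no  _ = point Q (m ∸ suc s)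

  J-before : ∀ {m} → m ≤ s → J m ≡ point P m
  J-before {m} m≤s with m ≤? s
  ... | yes _   = refl
  ... | no  m≰s = contradiction m≤s m≰s

  J-after : ∀ {m} i → suc s + i ≡ m → J m ≡ point Q i
  J-after i refl with suc s + i ≤? s
  ... | yes past = contradiction (≤-trans (s≤s (m≤m+n s i)) past) 1+n≰n
  ... | no  _    = cong (point Q) (m+n∸m≡n (suc s) i)

  J-steps : ∀ m → m < suc (s + t) → AltStep g (J m) (J (suc m))
  J-steps m m<len with <-cmp m s
  ... | tri< m<s _ _ =
    subst₂ (AltStep g) (sym (J-before (<⇒≤ m<s))) (sym (J-before m<s)) (steps P m m<s)
  ... | tri≈ _ refl _ =
    subst₂ (AltStep g) (sym (trans (J-before ≤-refl) (last P)))
                       (sym (trans (J-after 0 (cong suc (+-identityʳ s))) (first Q))) jump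
  ... | tri> _ _ s<m with m≤n⇒∃[o]m+o≡n s<m
  ...   | i , refl =
    subst₂ (AltStep g) (sym (J-after i refl)) (sym (J-after (suc i) (+-suc (suc s) i)))
           (steps Q i (+-cancelˡ-< (suc s) i t m<len))

altPath⇒chain : ∀ {n} {g : BoolFun n} →
  AltPath g n (replicate n false) (replicate n true) →
  Σ (Chain n) λ c → alternations g c ≡ n
altPath⇒chain {n} {g} P = chain , countTrue-all _ (λ i → proj₂ (stepAt i))
  where
  stepAt : (i : Fin n) → AltStep g (point P (toℕ (inject₁ i))) (point P (suc (toℕ i)))
  stepAt i rewrite toℕ-inject₁ i = steps P (toℕ i) (toℕ<n i)

  chain : Chain n
  chain = record
    { pt    = λ i → point P (toℕ i)
    ; start = first P
    ; end   = trans (cong (point P) (toℕ-fromℕ n)) (last P)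
    ; step  = λ i → altStep⇒≺ {g = g} (stepAt i)
    }

AgreeOff : ∀ {n} → Fin n → Vec Bool n → Vec Bool n → Set
AgreeOff i y x = ∀ j → i ≢ j → lookup y j ≡ lookup x j

record Sensitive {n} (g : BoolFun n) (x : Vec Bool n) {m} (σ : Fin m → Fin n) : Set where
  field
    distinct  : Injective _≡_ _≡_ σ
    neighbour : Fin m → Vec Bool n
    agreeOff  : ∀ i → AgreeOff (σ i) (neighbour i) x
    flips     : ∀ i → g (neighbour i) ≢ g x
open Sensitive

sensitive-cong : ∀ {n} {g h : BoolFun n} {x m} {σ : Fin m → Fin n} →
  (∀ y → g y ≡ h y) → Sensitive g x σ → Sensitive h x σ
sensitive-cong g≗h S = record
  { distinct = distinct S ; neighbour = neighbour S ; agreeOff = agreeOff S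
  ; flips = λ i eq → flips S i (trans (g≗h _) (trans eq (sym (g≗h _)))) }

sensitive-drop : ∀ {n} {g : BoolFun n} {x m} {σ : Fin (suc m) → Fin n} (i₀ : Fin (suc m)) →
  Sensitive g x σ → Sensitive g x (λ i → σ (punchIn i₀ i))
sensitive-drop i₀ S = record
  { distinct  = λ eq → punchIn-injective i₀ _ _ (distinct S eq)
  ; neighbour = λ i → neighbour S (punchIn i₀ i)
  ; agreeOff  = λ i → agreeOff S (punchIn i₀ i)
  ; flips     = λ i → flips S (punchIn i₀ i)
  }

branch : ∀ {n} → Bool → DTree n → DTree n → DTree n
branch b l r = if b then r else l

eval-node : ∀ {n} j (l r : DTree n) y → eval (node j l r) y ≡ eval (branch (lookup y j) l r) y
eval-node j l r y with lookup y j
... | true  = refl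
... | false = refl

depth-branch : ∀ {n} b (l r : DTree n) → depth (branch b l r) ≤ depth l ⊔ depth r
depth-branch true  l r = m≤n⊔m (depth l) (depth r)
depth-branch false l r = m≤m⊔n (depth l) (depth r)

onBranch : ∀ {n} {P : DTree n → Set} b {l r} → P l → P r → P (branch b l r)
onBranch true  _  pr = pr
onBranch false pl _  = pl

-- If the root variable j is none of the sensitive coordinates, every neighbour
-- is routed like x, so the sensitivity passes to the child that x visits.
sensitive-child : ∀ {n} {j} {l r : DTree n} {x m} {σ : Fin m → Fin n} →
  (∀ i → σ i ≢ j) → Sensitive (eval (node j l r)) x σ →
  Sensitive (eval (branch (lookup x j) l r)) x σ
sensitive-child {j = j} {l} {r} {x} σ≢j S = record
  { distinct = distinct S ; neighbour = neighbour S ; agreeOff = agreeOff S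
  ; flips = λ i eq → flips S i (trans (routed i) (trans eq (sym (eval-node j l r x)))) }
  where
  routed : ∀ i → eval (node j l r) (neighbour S i)
                 ≡ eval (branch (lookup x j) l r) (neighbour S i)
  routed i = trans (eval-node j l r _)
    (cong (λ b → eval (branch b l r) (neighbour S i)) (agreeOff S i j (σ≢j i)))

DepthBound : ∀ {n} → DTree n → Set
DepthBound {n} t = ∀ x {m} (σ : Fin m → Fin n) → Sensitive (eval t) x σ → m ≤ depth t

-- One query at x: the root variable j removes at most one sensitive coordinate
-- (dropped if it is among them), and the rest stay sensitive in the child that
-- x visits, whose depth is one less.
node-bound : ∀ {n} j (l r : DTree n) x → DepthBound (branch (lookup x j) l r) →
  ∀ {m} (σ : Fin m → Fin n) → Sensitive (eval (node j l r)) x σ → m ≤ depth (node j l r)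
node-bound j l r x child σ S with any? (λ i → σ i ≟ᶠ j)
... | no j∉σ =
  ≤-trans (child x σ (sensitive-child (λ i eq → j∉σ (i , eq)) S))
          (≤-trans (depth-branch (lookup x j) l r) (n≤1+n _))
node-bound j l r x child {suc m} σ S | yes (i₀ , σi₀≡j) =
  s≤s (≤-trans (child x _ (sensitive-child σ'≢j (sensitive-drop i₀ S)))
               (depth-branch (lookup x j) l r))
  where
  σ'≢j : ∀ i → σ (punchIn i₀ i) ≢ j
  σ'≢j i eq = punchInᵢ≢i i₀ i (distinct S (trans eq (sym σi₀≡j)))

sensitivity≤depth : ∀ {n} (t : DTree n) → DepthBound t
sensitivity≤depth (leaf b) x {zero}  σ S = z≤n
sensitivity≤depth (leaf b) x {suc m} σ S = ⊥-elim (flips S zero refl)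
sensitivity≤depth (node j l r) x =
  node-bound j l r x
    (onBranch {P = DepthBound} (lookup x j) (sensitivity≤depth l) (sensitivity≤depth r))

eval-relabel : ∀ {m n} (ρ : Fin m → Fin n) (t : DTree m) (x : Vec Bool n) (y : Vec Bool m) →
  (∀ i → lookup y i ≡ lookup x (ρ i)) → eval (relabel ρ t) x ≡ eval t y
eval-relabel ρ (leaf b)     x y y≡x∘ρ = refl
eval-relabel ρ (node i l r) x y y≡x∘ρ rewrite y≡x∘ρ i with lookup x (ρ i)
... | true  = eval-relabel ρ r x y y≡x∘ρ
... | false = eval-relabel ρ l x y y≡x∘ρ

depth-relabel : ∀ {m n} (ρ : Fin m → Fin n) (t : DTree m) → depth (relabel ρ t) ≡ depth t
depth-relabel ρ (leaf b)     = refl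
depth-relabel ρ (node i l r) = cong₂ (λ a b → suc (a ⊔ b)) (depth-relabel ρ l) (depth-relabel ρ r)

depth-full : ∀ k → depth (full k) ≡ suc k
depth-full zero    = refl
depth-full (suc k) rewrite depth-relabel (λ i → suc (i ↑ˡ sz (suc k))) (full k)
                         | depth-relabel (λ i → suc (sz (suc k) ↑ʳ i)) (full k)
                         | ⊔-idem (depth (full k)) | depth-full k = refl

splitInput : ∀ k (y : Vec Bool (sz (suc (suc k)))) →
  ∃ λ b → ∃₂ λ (yl yr : Vec Bool (sz (suc k))) → y ≡ b ∷ yl ++ yr
splitInput k (b ∷ y) with splitAt (sz (suc k)) y
... | yl , yr , y≡yl++yr = b , yl , yr , cong (b ∷_) y≡yl++yr

eval-full-suc : ∀ k b (yl yr : Vec Bool (sz (suc k))) →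
  eval (full (suc k)) (b ∷ yl ++ yr) ≡ (if b then eval (full k) yr else eval (full k) yl)
eval-full-suc k true  yl yr = eval-relabel _ (full k) _ yr (λ i → sym (lookup-++ʳ yl yr i))
eval-full-suc k false yl yr = eval-relabel _ (full k) _ yl (λ i → sym (lookup-++ˡ yl yr i))

eval-full-constant : ∀ k b (y : Vec Bool (sz (suc k))) → (∀ j → lookup y j ≡ b) →
  eval (full k) y ≡ b
eval-full-constant zero b (true  ∷ []) all-b = all-b zero
eval-full-constant zero b (false ∷ []) all-b = all-b zero
eval-full-constant (suc k) b y all-b with splitInput k y
... | c , yl , yr , refl = trans (eval-full-suc k c yl yr) (bothBlocks c)
  where
  bothBlocks : ∀ c' → (if c' then eval (full k) yr else eval (full k) yl) ≡ b
  bothBlocks true  = eval-full-constant k b yr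
    (λ j → trans (sym (lookup-++ʳ yl yr j)) (all-b (suc (sz (suc k) ↑ʳ j))))
  bothBlocks false = eval-full-constant k b yl
    (λ j → trans (sym (lookup-++ˡ yl yr j)) (all-b (suc (j ↑ˡ sz (suc k)))))

eval-full-replicate : ∀ k b → eval (full k) (replicate _ b) ≡ b
eval-full-replicate k b = eval-full-constant k b _ (λ j → lookup-replicate j b)

spineInput : ∀ k → Vec Bool (sz (suc k))
spineInput zero    = false ∷ []
spineInput (suc k) = false ∷ spineInput k ++ replicate _ true

spine : ∀ k → Fin (suc k) → Fin (sz (suc k))
spine zero    zero    = zero
spine (suc k) zero    = zero
spine (suc k) (suc i) = suc (spine k i ↑ˡ sz (suc k))

-- The spine variables are distinct: they lie at different depths.
spine-injective : ∀ k → Injective _≡_ _≡_ (spine k)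
spine-injective zero    {zero}  {zero}  _  = refl
spine-injective (suc k) {zero}  {zero}  _  = refl
spine-injective (suc k) {suc a} {suc b} eq =
  cong suc (spine-injective k (↑ˡ-injective _ _ _ (suc-injective eq)))

eval-spineInput : ∀ k → eval (full k) (spineInput k) ≡ false
eval-spineInput zero    = refl
eval-spineInput (suc k) = trans (eval-full-suc k false (spineInput k) _) (eval-spineInput k)

-- Setting a spine variable to 1 (and keeping the rest of spineInput) leads to
-- an all-1 right subtree, hence to value 1.
eval-spine-neighbour : ∀ k i (y : Vec Bool (sz (suc k))) → lookup y (spine k i) ≡ true →
  AgreeOff (spine k i) y (spineInput k) → eval (full k) y ≡ true
eval-spine-neighbour-split : ∀ k i b (yl yr : Vec Bool (sz (suc k))) →
  lookup (b ∷ yl ++ yr) (spine (suc k) i) ≡ true →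
  AgreeOff (spine (suc k) i) (b ∷ yl ++ yr) (spineInput (suc k)) →
  eval (full (suc k)) (b ∷ yl ++ yr) ≡ true

eval-spine-neighbour zero    zero (true ∷ []) _ _ = refl
eval-spine-neighbour (suc k) i    y set agree with splitInput k y
... | b , yl , yr , refl = eval-spine-neighbour-split k i b yl yr set agree

-- The root is set to 1: the right block still agrees with spineInput, i.e. is all 1.
eval-spine-neighbour-split k zero .true yl yr refl agree =
  trans (eval-full-suc k true yl yr) (eval-full-constant k true yr rightBlock)
  where
  rightBlock : ∀ j → lookup yr j ≡ true
  rightBlock j = trans (sym (lookup-++ʳ yl yr j))
    (trans (agree (suc (sz (suc k) ↑ʳ j)) (λ ()))
      (trans (lookup-++ʳ (spineInput k) _ j) (lookup-replicate j true)))
-- A deeper variable is set to 1: the root stays 0 and the left block is a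
-- spine neighbour for full k.
eval-spine-neighbour-split k (suc i) b yl yr set agree with agree zero (λ ())
... | refl = trans (eval-full-suc k false yl yr)
  (eval-spine-neighbour k i yl (trans (sym (lookup-++ˡ yl yr _)) set) leftBlock)
  where
  leftBlock : AgreeOff (spine k i) yl (spineInput k)
  leftBlock j i≢j = trans (sym (lookup-++ˡ yl yr j))
    (trans (agree (suc (j ↑ˡ _)) (λ eq → i≢j (↑ˡ-injective _ _ _ (suc-injective eq))))
      (lookup-++ˡ (spineInput k) _ j))

spine-sensitive : ∀ k → Sensitive (eval (full k)) (spineInput k) (spine k)
spine-sensitive k = record
  { distinct  = spine-injective k
  ; neighbour = neighbour'
  ; agreeOff  = agrees
  ; flips     = λ i eq → false≢true (trans (sym (eval-spineInput k)) (trans (sym eq) (isTrue i)))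
  }
  where
  neighbour' : Fin (suc k) → Vec Bool (sz (suc k))
  neighbour' i = spineInput k [ spine k i ]≔ true
  agrees : ∀ i → AgreeOff (spine k i) (neighbour' i) (spineInput k)
  agrees i j i≢j = lookup∘update′ (λ eq → i≢j (sym eq)) (spineInput k) true
  isTrue : ∀ i → eval (full k) (neighbour' i) ≡ true
  isTrue i = eval-spine-neighbour k i (neighbour' i)
    (lookup∘update (spine k i) (spineInput k) true) (agrees i)

replicate-++ : ∀ {A : Set} a c (b : A) →
  replicate a b ++ replicate c b ≡ replicate (a + c) b
replicate-++ zero    c b = refl
replicate-++ (suc a) c b = cong (b ∷_) (replicate-++ a c b)

-- full k changes its value at each of the s steps of a path from 0^s to 1^s:
-- the path through the left block, the switch of the root, the path through
-- the right block.
full-altPath : ∀ k → AltPath (eval (full k)) (sz (suc k)) (replicate _ false) (replicate _ true)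
full-altPath zero    = joinPath (stay _) (f≤t ∷ [] , refl) (stay _)
full-altPath (suc k) =
  subst₂ (AltPath (eval (full (suc k))) (sz (suc (suc k))))
         (cong (false ∷_) (replicate-++ s s false)) (cong (true ∷_) (replicate-++ s s true))
         (joinPath leftPath (f≤t ∷ ≼-refl , switch) rightPath)
  where
  s = sz (suc k)
  0s 1s : Vec Bool s
  0s = replicate s false
  1s = replicate s true
  inLeft inRight : Vec Bool s → Vec Bool (sz (suc (suc k)))
  inLeft  y = false ∷ y ++ 0s
  inRight y = true ∷ 1s ++ y

  leftPath : AltPath (eval (full (suc k))) s (inLeft 0s) (inLeft 1s)
  leftPath = mapPath inLeft (λ x≼y → b≤b ∷ ++⁺ x≼y ≼-refl)
                     (λ y → eval-full-suc k false y _) (full-altPath k)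

  rightPath : AltPath (eval (full (suc k))) s (inRight 0s) (inRight 1s)
  rightPath = mapPath inRight (λ x≼y → b≤b ∷ ++⁺ ≼-refl x≼y)
                      (λ y → eval-full-suc k true _ y) (full-altPath k)

  -- The middle step: the root goes from 0 to 1 with the left block all 1 and
  -- the right block all 0, so the evaluated block changes from 1s to 0s.
  switch : eval (full (suc k)) (inLeft 1s) xor eval (full (suc k)) (inRight 0s) ≡ true
  switch = cong₂ _xor_
    (trans (eval-full-suc k false 1s 0s) (eval-full-replicate k true))
    (trans (eval-full-suc k true  1s 0s) (eval-full-replicate k false))

full-alt : ∀ k → IsAlt (eval (full k)) (sz (suc k))
full-alt k = altPath⇒chain (full-altPath k) , alternations-≤ (eval (full k))

full-DT : ∀ k → IsDT (eval (full k)) (suc k)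
full-DT k = (full k , (λ _ → refl) , depth-full k) , lowerBound
  where
  lowerBound : (t : DTree (sz (suc k))) → Computes t (eval (full k)) → suc k ≤ depth t
  lowerBound t t-computes = sensitivity≤depth t (spineInput k) (spine k)
    (sensitive-cong (λ y → sym (t-computes y)) (spine-sensitive k))

theorem6 : (k : ℕ) → .{{_ : NonZero k}} →
    Σ ℕ λ a → Σ ℕ λ d → IsAlt (f k) a × IsDT (f k) d × a ≡ 2 ^ d ∸ 1
theorem6 zero    = ⊥-elim (≢-nonZero⁻¹ 0 refl)
theorem6 (suc k) = sz (suc k) , suc k , full-alt k , full-DT k , cong (_∸ 1) (sz-spec (suc k))
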